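{- The subspace of $\textsf{ParSym}$ spanned by $\{\textsf{H}_\pi : \pi \text{ a perfect matching}\}$ is a Hopf subalgebra of $\textsf{ParSym}$: it contains $\textsf{H}_\varnothing$, is closed under the product, $\Delta$ maps it into its tensor square, and the antipode $S$ maps it into itself.
   Context: Partition diagrams of order $k$ are set partitions of $\{1,\ldots,k,1',\ldots,k'\}$; $A_0=\{\varnothing\}$. A perfect matching is a partition diagram all of whose blocks have size exactly two (the empty diagram counts as one). For $\pi$ of order $k$, $\rho$ of order $l$: $\pi\otimes\rho$ has as blocks those of $\pi$ and those of $\rho$ shifted ($i\mapsto i+k$, $i'\mapsto(i+k)'$). A diagram is $\otimes$-irreducible if it is not $\rho^{(1)}\otimes\rho^{(2)}$ with both factors nonempty. For nonempty $\pi,\rho$ (orders $k,l$), $\pi\bullet\rho$ is obtained from $\pi\otimes\rho$ by merging the block containing $k'$ with the block containing $(k+1)'$; $\varnothing\bullet\rho=\rho$, $\pi\bullet\varnothing=\pi$. Over a field $\mathbbm{k}$, $\textsf{ParSym}$ has basis $\{\textsf{H}_\pi\}$ over all partition diagrams, product $\textsf{H}_\pi\textsf{H}_\rho=\textsf{H}_{\pi\otimes\rho}$, unit $\textsf{H}_\varnothing$ (free on $\textsf{H}_\pi$, $\pi$ nonempty $\otimes$-irreducible). $\Delta$ is the algebra morphism with $\Delta\textsf{H}_\varnothing=\textsf{H}_\varnothing\otimes\textsf{H}_\varnothing$ and $\Delta\textsf{H}_\pi=\sum\textsf{H}_{G_1}\otimes\textsf{H}_{G_2}$ for nonempty $\otimes$-irreducible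 $\pi$, over ordered pairs $(G_1,G_2)$, each $\varnothing$ or $\otimes$-irreducible, with $G_1\bullet G_2=\pi$. $S$ is the linear antimorphism with $S(\textsf{H}_\varnothing)=\textsf{H}_\varnothing$ and $S(\textsf{H}_\pi)=\sum(-1)^\ell\textsf{H}_{\rho^{(1)}}\cdots\textsf{H}_{\rho^{(\ell)}}$ for nonempty $\otimes$-irreducible $\pi$, over tuples of nonempty diagrams with $\rho^{(1)}\bullet\cdots\bullet\rho^{(\ell)}=\pi$. -}

module Defs where

open import Level using (Level) renaming (suc to lsuc)
open import Data.Bool using (Bool; true; false; if_then_else_; _∧_; _∨_; not; T)
open import Data.Nat using (ℕ; zero; suc; _+_; _∸_; _≟_; _≡ᵇ_)
  renaming (_⊔_ to _⊔ℕ_)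
open import Data.Fin using (Fin)
open import Data.Vec as V using (Vec; []; _∷_)
open import Data.List as L using (List; []; _∷_; [_]; _++_; concatMap; map; filter; foldr; upTo; allFin)
open import Data.List.Relation.Unary.All using (All)
open import Data.Product using (Σ; Σ-syntax; ∃; _×_; _,_; proj₁; proj₂)
open import Relation.Nullary using (¬_; yes; no)
open import Relation.Binary.PropositionalEquality using (_≡_; refl)
open import Algebra.Bundles using (CommutativeRing)

record Field (c ℓ : Level) : Set (lsuc (c Level.⊔ ℓ)) where
  field
    commutativeRing : CommutativeRing c ℓ
  open CommutativeRing commutativeRing public
  field
    0≉1     : ¬ (0# ≈ 1#)
    inverse : ∀ x → ¬ (x ≈ 0#) → Σ Carrier (λ y → (x * y) ≈ 1#)

-- A partition diagram of order k is given by a labelling of the points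
-- 1..k (top) and 1'..k' (bottom) by natural numbers; two points lie in
-- the same block iff they carry the same label.  Different labellings
-- can describe the same diagram; diagrams are compared with `sameB`
-- (same set partition), and all enumerations below list every set
-- partition exactly once (via its canonical = restricted-growth labelling).

Diagram : ℕ → Set
Diagram k = Vec ℕ k × Vec ℕ k   -- (labels of 1..k , labels of 1'..k')

Basis : Set
Basis = Σ ℕ Diagram

order : Basis → ℕ
order = proj₁

∅ : Basis
∅ = 0 , ([] , [])

labels : ∀ {k} → Diagram k → Vec ℕ (k + k)
labels (t , b) = t V.++ b

sameD : ∀ {k} → Diagram k → Diagram k → Bool
sameD {k} π ρ =
  allL (λ i → allL (λ j →
      (V.lookup (labels π) i ≡ᵇ V.lookup (labels π) j)
        ≡ᵇB (V.lookup (labels ρ) i ≡ᵇ V.lookup (labels ρ) j))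
    (allFin (k + k))) (allFin (k + k))
  where
  allL : ∀ {A : Set} → (A → Bool) → List A → Bool
  allL p = foldr (λ a acc → p a ∧ acc) true
  _≡ᵇB_ : Bool → Bool → Bool
  true  ≡ᵇB y = y
  false ≡ᵇB y = not y

sameB : Basis → Basis → Bool
sameB (k , π) (l , ρ) with k ≟ l
... | yes refl = sameD π ρ
... | no _     = false

private
  pos : ℕ → List ℕ → ℕ
  pos x []       = 0
  pos x (y ∷ ys) = if x ≡ᵇ y then 0 else suc (pos x ys)

  elem : ℕ → List ℕ → Bool
  elem x []       = false
  elem x (y ∷ ys) = (x ≡ᵇ y) ∨ elem x ys

  norm : ∀ {n} → List ℕ → Vec ℕ n → Vec ℕ n × List ℕ
  norm seen []       = [] , seen
  norm seen (x ∷ xs) with norm (if elem x seen then seen else seen ++ [ x ]) xs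
  ... | ys , s = pos x seen ∷ ys , s

  vecEq : ∀ {n} → Vec ℕ n → Vec ℕ n → Bool
  vecEq []       []       = true
  vecEq (x ∷ xs) (y ∷ ys) = (x ≡ᵇ y) ∧ vecEq xs ys

isCanonical : ∀ {k} → Diagram k → Bool
isCanonical (t , b) with norm [] t
... | t' , s = vecEq t t' ∧ vecEq b (proj₁ (norm s b))

private
  vecsBelow : ℕ → (n : ℕ) → List (Vec ℕ n)
  vecsBelow m zero    = [ [] ]
  vecsBelow m (suc n) =
    concatMap (λ x → map (x ∷_) (vecsBelow m n)) (upTo m)

allDiagrams : (k : ℕ) → List (Diagram k)
allDiagrams k =
  filter (λ π → T? (isCanonical π))
    (concatMap (λ t → map (t ,_) (vecsBelow (k + k) k)) (vecsBelow (k + k) k))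
  where
  open import Relation.Nullary.Decidable using () renaming (T? to T?₀)
  T? = T?₀

allBasisOfOrder : ℕ → List Basis
allBasisOfOrder k = map (k ,_) (allDiagrams k)

private
  count : ∀ {n} → (ℕ → Bool) → Vec ℕ n → ℕ
  count p []       = 0
  count p (x ∷ xs) = if p x then suc (count p xs) else count p xs

isPerfectMatching : Basis → Bool
isPerfectMatching (k , π) =
  V.foldr (λ _ → Bool) (λ x acc → (count (x ≡ᵇ_) (labels π) ≡ᵇ 2) ∧ acc)
    true (labels π)

PerfectMatching : Basis → Set
PerfectMatching π = T (isPerfectMatching π)

private
  maxLabel : ∀ {k} → Diagram k → ℕ
  maxLabel π = V.foldr (λ _ → ℕ) _⊔ℕ_ 0 (labels π)

_⊗D_ : ∀ {k l} → Diagram k → Diagram l → Diagram (k + l)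
(t₁ , b₁) ⊗D (t₂ , b₂) =
  (t₁ V.++ V.map (_+ off) t₂) , (b₁ V.++ V.map (_+ off) b₂)
  where off = suc (maxLabel (t₁ , b₁))

_⊗B_ : Basis → Basis → Basis
(k , π) ⊗B (l , ρ) = (k + l) , (π ⊗D ρ)

-- π • ρ : π ⊗ ρ with the blocks of k' and (k+1)' merged
_•_ : Basis → Basis → Basis
(zero , _) • ρ = ρ
(suc k , π) • (zero , _) = (suc k , π)
(suc k , (t₁ , b₁)) • (suc l , (t₂ , b₂)) =
  (suc k + suc l) , (V.map merge t , V.map merge b)
  where
  off = suc (maxLabel (t₁ , b₁))
  tb  = (t₁ , b₁) ⊗D (t₂ , b₂)
  t   = proj₁ tb
  b   = proj₂ tb
  lk  = V.last b₁
  lk1 = V.head b₂ + off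
  merge : ℕ → ℕ
  merge x = if x ≡ᵇ lk1 then lk else x

private
  positiveSplits : ℕ → List (ℕ × ℕ)
  positiveSplits n = map (λ j → suc j , n ∸ suc j) (upTo (n ∸ 1))

-- all ways of writing π = ρ₁ ⊗ ρ₂ with ρ₁, ρ₂ nonempty, ordered by the
-- order of ρ₁ (increasing)
decompositions : Basis → List (Basis × Basis)
decompositions π =
  filter (λ p → T? (sameB (proj₁ p ⊗B proj₂ p) π))
    (concatMap (λ jl → concatMap (λ ρ₁ → map (ρ₁ ,_) (allBasisOfOrder (proj₂ jl)))
                                 (allBasisOfOrder (proj₁ jl)))
               (positiveSplits (order π)))
  where
  open import Relation.Nullary.Decidable using () renaming (T? to T?₀)
  T? = T?₀

isIrreducible : Basis → Bool
isIrreducible π = L.null (decompositions π)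

-- the (unique) factorisation π = π₁ ⊗ ⋯ ⊗ πₘ into nonempty ⊗-irreducibles
-- (first argument is fuel; `order π` suffices)
private
  factorsF : ℕ → Basis → List Basis
  factorsF _       (zero , _) = []
  factorsF zero    π          = [ π ]
  factorsF (suc f) π with decompositions π
  ... | []             = [ π ]
  ... | (ρ₁ , ρ₂) ∷ _  = ρ₁ ∷ factorsF f ρ₂

irreducibleFactors : Basis → List Basis
irreducibleFactors π = factorsF (order π) π

private
  tuplesF : ℕ → ℕ → List (List Basis)
  tuplesF _       zero    = [ [] ]
  tuplesF zero    (suc n) = []
  tuplesF (suc f) (suc n) =
    concatMap (λ j → concatMap (λ ρ → map (ρ ∷_) (tuplesF f (suc n ∸ suc j)))
                               (allBasisOfOrder (suc j)))
              (upTo (suc n))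

tuplesOfTotalOrder : ℕ → List (List Basis)
tuplesOfTotalOrder n = tuplesF n n

-- ρ⁽¹⁾ • ⋯ • ρ⁽ℓ⁾  (• is associative; we bracket to the right)
bulletAll : List Basis → Basis
bulletAll = foldr _•_ ∅

-- ParSym over a field, as finite formal linear combinations of the
-- basis {H_π}, compared coefficientwise.

module ParSym {c ℓ} (F : Field c ℓ) where
  open Field F renaming (_+_ to _+F_)

  ParSym : Set c
  ParSym = List (Carrier × Basis)

  ParSym⊗ParSym : Set c
  ParSym⊗ParSym = List (Carrier × Basis × Basis)

  coeff : ParSym → Basis → Carrier
  coeff x π = foldr (λ p acc → if sameB (proj₂ p) π then proj₁ p +F acc else acc) 0# x

  coeff₂ : ParSym⊗ParSym → Basis → Basis → Carrier
  coeff₂ z π ρ =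
    foldr (λ p acc → if sameB (proj₁ (proj₂ p)) π ∧ sameB (proj₂ (proj₂ p)) ρ
                     then proj₁ p +F acc else acc) 0# z

  _≈P_ : ParSym → ParSym → Set ℓ
  x ≈P y = ∀ π → coeff x π ≈ coeff y π

  _≈P₂_ : ParSym⊗ParSym → ParSym⊗ParSym → Set ℓ
  z ≈P₂ w = ∀ π ρ → coeff₂ z π ρ ≈ coeff₂ w π ρ

  H : Basis → ParSym
  H π = [ (1# , π) ]

  scale : Carrier → ParSym → ParSym
  scale a = map (λ p → (a * proj₁ p) , proj₂ p)

  scale₂ : Carrier → ParSym⊗ParSym → ParSym⊗ParSym
  scale₂ a = map (λ p → (a * proj₁ p) , proj₂ p)

  _·_ : ParSym → ParSym → ParSym
  x · y = concatMap (λ p → map (λ q → (proj₁ p * proj₁ q) , (proj₂ p ⊗B proj₂ q)) y) x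

  _·₂_ : ParSym⊗ParSym → ParSym⊗ParSym → ParSym⊗ParSym
  z ·₂ w = concatMap (λ p → map (λ q →
              (proj₁ p * proj₁ q) ,
              (proj₁ (proj₂ p) ⊗B proj₁ (proj₂ q)) ,
              (proj₂ (proj₂ p) ⊗B proj₂ (proj₂ q))) w) z

  Δirr : Basis → ParSym⊗ParSym
  Δirr π =
    map (λ g → 1# , g)
      (filter (λ g → T? (((order (proj₁ g) ≡ᵇ 0) ∨ isIrreducible (proj₁ g)) ∧
                         ((order (proj₂ g) ≡ᵇ 0) ∨ isIrreducible (proj₂ g)) ∧
                         sameB (proj₁ g • proj₂ g) π))
        (concatMap (λ j → concatMap (λ G₁ → map (G₁ ,_)
                                       (allBasisOfOrder (order π ∸ j)))
                                     (allBasisOfOrder j))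
                   (upTo (suc (order π)))))
    where
    open import Relation.Nullary.Decidable using () renaming (T? to T?₀)
    T? = T?₀

  -- Δ is the algebra morphism extending Δirr (Δ H_∅ = H_∅ ⊗ H_∅)
  ΔH : Basis → ParSym⊗ParSym
  ΔH π = foldr (λ f acc → Δirr f ·₂ acc) [ (1# , ∅ , ∅) ] (irreducibleFactors π)

  Δ : ParSym → ParSym⊗ParSym
  Δ x = concatMap (λ p → scale₂ (proj₁ p) (ΔH (proj₂ p))) x

  sign : ℕ → Carrier
  sign zero    = 1#
  sign (suc n) = (- 1#) * sign n

  Sirr : Basis → ParSym
  Sirr π =
    concatMap (λ ρs → scale (sign (L.length ρs)) (foldr (λ ρ acc → H ρ · acc) (H ∅) ρs))
      (filter (λ ρs → T? (sameB (bulletAll ρs) π)) (tuplesOfTotalOrder (order π)))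
    where
    open import Relation.Nullary.Decidable using () renaming (T? to T?₀)
    T? = T?₀

  -- S is the linear antimorphism extending Sirr:
  --   S(H_{π₁} ⋯ H_{πₘ}) = S(H_{πₘ}) ⋯ S(H_{π₁})
  SH : Basis → ParSym
  SH π = foldr (λ f acc → acc · Sirr f) (H ∅) (irreducibleFactors π)

  S : ParSym → ParSym
  S x = concatMap (λ p → scale (proj₁ p) (SH (proj₂ p))) x

  InPMSpan : ParSym → Set (c Level.⊔ ℓ)
  InPMSpan x = Σ[ ys ∈ List (Carrier × Basis) ]
                 (All (λ p → PerfectMatching (proj₂ p)) ys × (x ≈P ys))

  InPMSpan⊗PMSpan : ParSym⊗ParSym → Set (c Level.⊔ ℓ)
  InPMSpan⊗PMSpan z = Σ[ ws ∈ List (Carrier × Basis × Basis) ]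
                 (All (λ p → PerfectMatching (proj₁ (proj₂ p)) ×
                             PerfectMatching (proj₂ (proj₂ p))) ws × (z ≈P₂ ws))

-- A product of perfect matchings is a perfect matching, and conversely if
-- ρ₁ ⊗ ρ₂ or ρ₁ • ρ₂ is a perfect matching then so are ρ₁ and ρ₂.  For ⊗ the
-- blocks are simply shared out.  For • with both factors nonempty it cannot
-- happen: the merged block would need k′ to be a singleton of ρ₁, while all other
-- blocks of ρ₁ are pairs and ρ₁ has an even number of points.  Hence every term
-- in the defining sums of Δ(H_π) and S(H_π), π a perfect matching, is indexed by
-- perfect matchings, and H_∅ and products stay in the span.
--
-- Diagrams are labellings compared by `sameB`, and elements of ParSym are lists
-- compared coefficientwise, so the operations must also respect that comparison:
-- a linear functional that only depends on the set partition takes equal values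
-- on lists with equal coefficients.

module Submission where

open import Defs
open import Level using (Level)
open import Algebra.Bundles using (CommutativeRing)
open import Data.Bool using (Bool; true; false; T; _∧_; _∨_; if_then_else_; not)
open import Data.Bool.Properties using (T-≡; ⇔→≡)
open import Data.Empty using (⊥-elim)
open import Data.Fin as Fin using (Fin)
open import Data.List as L using (List; []; _∷_; _++_; allFin)
open import Data.List.Properties using (map-id; map-++; foldr-cong; foldr-map; foldr-preservesᵇ; filter-≐)
open import Data.List.Membership.Propositional using (_∈_)
open import Data.List.Membership.Propositional.Properties
  using (∈-allFin; ∈-filter⁻; ∈-map⁺; ∈-map⁻; ∈-++⁺ˡ; ∈-++⁺ʳ; ∈-++⁻)
open import Data.List.Relation.Unary.All as All using (All; []; _∷_)
import Data.List.Relation.Unary.All.Properties as All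
open import Data.List.Relation.Unary.Any using (here; there)
open import Data.Nat as ℕ using (ℕ; zero; suc; _+_; _⊔_; _∸_; _≤_; _<_; _≟_; _≡ᵇ_; _<?_; z≤n; s≤s)
open import Data.Nat.Properties
open import Algebra.Properties.CommutativeSemigroup +-commutativeSemigroup using (interchange)
open import Data.Product using (Σ; ∃; _×_; _,_; proj₁; proj₂)
open import Data.Sum using (inj₁; inj₂)
open import Data.Unit using (tt)
open import Data.Vec as V using (Vec; []; _∷_)
open import Data.Vec.Properties as VP using (toList-++; toList-map; length-toList)
open import Function using (_∘_; id; Equivalence; mk⇔)
open import Relation.Binary.PropositionalEquality hiding ([_])
open import Relation.Nullary using (¬_; yes; no; proof)
open import Relation.Nullary.Decidable using (T?)
open import Relation.Nullary.Reflects using (Reflects; ofʸ; ofⁿ)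

-- Occurrence counts and parity

≡ᵇ-reflects : ∀ x y → Reflects (x ≡ y) (x ≡ᵇ y)
≡ᵇ-reflects x y = proof (x ≟ y)

≡ᵇ-refl : ∀ x → (x ≡ᵇ x) ≡ true
≡ᵇ-refl x with x ≡ᵇ x | ≡ᵇ-reflects x x
... | true  | _      = refl
... | false | ofⁿ ¬p = ⊥-elim (¬p refl)

≢⇒≡ᵇ-false : ∀ {x y} → x ≢ y → (x ≡ᵇ y) ≡ false
≢⇒≡ᵇ-false {x} {y} x≢y with x ≡ᵇ y | ≡ᵇ-reflects x y
... | true  | ofʸ p = ⊥-elim (x≢y p)
... | false | _     = refl

≡ᵇ-sym : ∀ x y → (x ≡ᵇ y) ≡ (y ≡ᵇ x)
≡ᵇ-sym x y with x ≡ᵇ y | ≡ᵇ-reflects x y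
... | true  | ofʸ refl = sym (≡ᵇ-refl x)
... | false | ofⁿ x≢y  = sym (≢⇒≡ᵇ-false (x≢y ∘ sym))

≡ᵇ-+-cancelʳ : ∀ o x y → (x + o ≡ᵇ y + o) ≡ (x ≡ᵇ y)
≡ᵇ-+-cancelʳ o x y with x ≡ᵇ y | ≡ᵇ-reflects x y
... | true  | ofʸ refl = ≡ᵇ-refl (x + o)
... | false | ofⁿ x≢y  = ≢⇒≡ᵇ-false (x≢y ∘ +-cancelʳ-≡ o x y)

∧≡true⇒ʳ : ∀ x {y} → x ∧ y ≡ true → y ≡ true
∧≡true⇒ʳ true y≡true = y≡true

occ : ℕ → List ℕ → ℕ
occ x []       = 0
occ x (y ∷ ys) = if x ≡ᵇ y then suc (occ x ys) else occ x ys

occ-++ : ∀ x xs ys → occ x (xs ++ ys) ≡ occ x xs + occ x ys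
occ-++ x []       ys = refl
occ-++ x (y ∷ xs) ys with x ≡ᵇ y
... | true  = cong suc (occ-++ x xs ys)
... | false = occ-++ x xs ys

occ-∷-self : ∀ x xs → occ x (x ∷ xs) ≡ suc (occ x xs)
occ-∷-self x xs rewrite ≡ᵇ-refl x = refl

∈⇒occ-pos : ∀ {x xs} → x ∈ xs → 0 < occ x xs
∈⇒occ-pos {x} {_ ∷ xs} (here refl) rewrite ≡ᵇ-refl x = s≤s z≤n
∈⇒occ-pos {x} {y ∷ _}  (there x∈) with x ≡ᵇ y
... | true  = s≤s z≤n
... | false = ∈⇒occ-pos x∈

occ-pos⇒∈ : ∀ {x} xs → 0 < occ x xs → x ∈ xs
occ-pos⇒∈ {x} (y ∷ xs) pos with x ≡ᵇ y | ≡ᵇ-reflects x y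
... | true  | ofʸ x≡y = here x≡y
... | false | _       = there (occ-pos⇒∈ xs pos)

occ-∉ : ∀ {x xs} → All (x ≢_) xs → occ x xs ≡ 0
occ-∉ []              = refl
occ-∉ (x≢y ∷ x≢ys) rewrite ≢⇒≡ᵇ-false x≢y = occ-∉ x≢ys

occ-map : ∀ {A : Set} (f g : A → ℕ) x y (zs : List A) →
          (∀ {z} → z ∈ zs → (x ≡ᵇ f z) ≡ (y ≡ᵇ g z)) →
          occ x (L.map f zs) ≡ occ y (L.map g zs)
occ-map f g x y []       agree = refl
occ-map f g x y (z ∷ zs) agree rewrite agree (here refl) with y ≡ᵇ g z
... | true  = cong suc (occ-map f g x y zs (agree ∘ there))
... | false = occ-map f g x y zs (agree ∘ there)

occ-map-+ : ∀ o x xs → occ (x + o) (L.map (_+ o) xs) ≡ occ x xs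
occ-map-+ o x xs =
  trans (occ-map (_+ o) id (x + o) x xs (λ {z} _ → ≡ᵇ-+-cancelʳ o x z)) (cong (occ x) (map-id xs))

occ-bounded : ∀ {o y xs} → All (_< o) xs → o ≤ y → occ y xs ≡ 0
occ-bounded xs<o o≤y = occ-∉ (All.map (λ z<o y≡z → <⇒≱ z<o (subst (_ ≤_) y≡z o≤y)) xs<o)

occ-map-+-< : ∀ {y o} xs → y < o → occ y (L.map (_+ o) xs) ≡ 0
occ-map-+-< {y} {o} xs y<o =
  occ-∉ (All.tabulate {xs = L.map (_+ o) xs} λ y∈ y≡ → let z , _ , e = ∈-map⁻ (_+ o) y∈ in
           <⇒≱ y<o (subst (o ≤_) (sym (trans y≡ e)) (m≤n+m o z)))

PairedAt : List ℕ → ℕ → Set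
PairedAt xs x = 0 < occ x xs → occ x xs ≡ 2

Paired : List ℕ → Set
Paired xs = ∀ x → PairedAt xs x

removeAll : ℕ → List ℕ → List ℕ
removeAll x []       = []
removeAll x (y ∷ ys) = if x ≡ᵇ y then removeAll x ys else y ∷ removeAll x ys

length-removeAll : ∀ x xs → L.length xs ≡ occ x xs + L.length (removeAll x xs)
length-removeAll x []       = refl
length-removeAll x (y ∷ ys) with x ≡ᵇ y
... | true  = cong suc (length-removeAll x ys)
... | false = trans (cong suc (length-removeAll x ys)) (sym (+-suc _ _))

occ-removeAll-self : ∀ x xs → occ x (removeAll x xs) ≡ 0
occ-removeAll-self x []       = refl
occ-removeAll-self x (y ∷ ys) with x ≡ᵇ y in x≡ᵇy
... | true  = occ-removeAll-self x ys
... | false rewrite x≡ᵇy = occ-removeAll-self x ys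

occ-removeAll : ∀ {x y} xs → y ≢ x → occ y (removeAll x xs) ≡ occ y xs
occ-removeAll     []       y≢x = refl
occ-removeAll {x} {y} (z ∷ zs) y≢x with x ≡ᵇ z | ≡ᵇ-reflects x z
... | true  | ofʸ refl rewrite ≢⇒≡ᵇ-false y≢x = occ-removeAll zs y≢x
... | false | _ with y ≡ᵇ z
...   | true  = cong suc (occ-removeAll zs y≢x)
...   | false = occ-removeAll zs y≢x

Paired-removeAll : ∀ x xs → Paired xs → Paired (removeAll x xs)
Paired-removeAll x xs paired y pos with y ≟ x
... | yes refl = ⊥-elim (<⇒≢ pos (sym (occ-removeAll-self x xs)))
... | no y≢x   rewrite occ-removeAll xs y≢x = paired y pos

Paired⇒even-length : ∀ xs → Paired xs → ∃ λ m → L.length xs ≡ 2 ℕ.* m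
Paired⇒even-length xs = go (L.length xs) xs ≤-refl
  where
  go : ∀ n xs → L.length xs ≤ n → Paired xs → ∃ λ m → L.length xs ≡ 2 ℕ.* m
  go _       []       _          _      = 0 , refl
  go (suc n) (x ∷ xs) (s≤s |xs|≤n) paired =
    let rest         = removeAll x (x ∷ xs)
        length-split = length-removeAll x (x ∷ xs)
        twice        = paired x (∈⇒occ-pos {xs = x ∷ xs} (here refl))
        shorter      = suc-injective (trans (cong (_+ L.length rest) (sym twice)) (sym length-split))
        |rest|≤n     = ≤-trans (n≤1+n _) (subst (_≤ n) (sym shorter) |xs|≤n)
        m , even     = go n rest |rest|≤n (Paired-removeAll x (x ∷ xs) paired)
    in suc m , (begin
      L.length (x ∷ xs)        ≡⟨ length-split ⟩
      occ x (x ∷ xs) + L.length rest ≡⟨ cong₂ _+_ twice even ⟩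
      2 + 2 ℕ.* m             ≡⟨ sym (*-suc 2 m) ⟩
      2 ℕ.* suc m               ∎)
    where open ≡-Reasoning

-- Perfect matchings, ⊗ and •

lab : Basis → List ℕ
lab (k , π) = V.toList (labels π)

offset : Basis → ℕ
offset (k , (t , b)) = suc (V.foldr (λ _ → ℕ) _⊔_ 0 (t V.++ b))

lab-<-offset : ∀ σ → All (_< offset σ) (lab σ)
lab-<-offset (k , (t , b)) = All.map s≤s (≤-max (t V.++ b))
  where
  ≤-max : ∀ {n} (w : Vec ℕ n) → All (_≤ V.foldr (λ _ → ℕ) _⊔_ 0 w) (V.toList w)
  ≤-max []      = []
  ≤-max (x ∷ w) = m≤m⊔n x _ ∷ All.map (λ z≤ → ≤-trans z≤ (m≤n⊔m x _)) (≤-max w)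

allᵇ : ∀ {A : Set} → (A → Bool) → List A → Bool
allᵇ p = L.foldr (λ a acc → p a ∧ acc) true

foldr-toList : ∀ {n} {f g : ℕ → Bool → Bool} → (∀ x acc → f x acc ≡ g x acc) →
               (w : Vec ℕ n) → V.foldr (λ _ → Bool) f true w ≡ L.foldr g true (V.toList w)
foldr-toList     same []      = refl
foldr-toList {f = f} same (x ∷ w) = trans (cong (f x) (foldr-toList same w)) (same x _)

allᵇ⇒ : ∀ {A : Set} (p : A → Bool) xs → allᵇ p xs ≡ true → ∀ {a} → a ∈ xs → p a ≡ true
allᵇ⇒ p (x ∷ xs) pass (here refl) with p x
... | true = refl
allᵇ⇒ p (x ∷ xs) pass (there a∈) with p x
... | true = allᵇ⇒ p xs pass a∈

allᵇ⇐ : ∀ {A : Set} (p : A → Bool) xs → (∀ {a} → a ∈ xs → p a ≡ true) → allᵇ p xs ≡ true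
allᵇ⇐ p []       pass = refl
allᵇ⇐ p (x ∷ xs) pass rewrite pass (here refl) = allᵇ⇐ p xs (pass ∘ there)

-- Defs counts with a private function.  The three tests that `isPerfectMatching`
-- passes through ("occurs twice", "once", "never") are named below as solutions
-- of unification problems, the `with` turning each into a pattern, and are then
-- expressed by `occ`.
private
  Test : Set
  Test = ∀ {n} → Vec ℕ n → ℕ → Bool → Bool

  StepsTo : Test → Test → Set
  StepsTo test test′ =
    ∀ x y {n} (w : Vec ℕ n) acc → (x ≡ᵇ y) ≡ true → test (y ∷ w) x acc ≡ test′ w x acc

  Unfolds : Test → Set
  Unfolds test = ∀ k (t b : Vec ℕ k) (w : Σ ℕ (Vec ℕ)) → (k + k , t V.++ b) ≡ w →
                 isPerfectMatching (k , (t , b)) ≡ V.foldr (λ _ → Bool) (test (proj₂ w)) true (proj₂ w)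

  twice : Σ Test Unfolds
  twice = _ , unfold
    where
    unfold : Unfolds _
    unfold k t b w eq with k + k | t V.++ b | eq
    ... | _ | _ | refl = refl

  once : Σ Test (StepsTo (proj₁ twice))
  once = _ , step
    where
    step : StepsTo (proj₁ twice) _
    step x y w acc x≡ᵇy rewrite x≡ᵇy = refl

  never : Σ Test (StepsTo (proj₁ once))
  never = _ , step
    where
    step : StepsTo (proj₁ once) _
    step x y w acc x≡ᵇy rewrite x≡ᵇy = refl

  never-occ : ∀ x {n} (w : Vec ℕ n) acc → proj₁ never w x acc ≡ ((occ x (V.toList w) ≡ᵇ 0) ∧ acc)
  never-occ x []      acc = refl
  never-occ x (y ∷ w) acc with x ≡ᵇ y
  ... | true  = refl
  ... | false = never-occ x w acc

  once-occ : ∀ x {n} (w : Vec ℕ n) acc → proj₁ once w x acc ≡ ((occ x (V.toList w) ≡ᵇ 1) ∧ acc)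
  once-occ x []      acc = refl
  once-occ x (y ∷ w) acc with x ≡ᵇ y
  ... | true  = never-occ x w acc
  ... | false = once-occ x w acc

  twice-occ : ∀ x {n} (w : Vec ℕ n) acc → proj₁ twice w x acc ≡ ((occ x (V.toList w) ≡ᵇ 2) ∧ acc)
  twice-occ x []      acc = refl
  twice-occ x (y ∷ w) acc with x ≡ᵇ y
  ... | true  = once-occ x w acc
  ... | false = twice-occ x w acc

isPerfectMatching-occ : ∀ σ → isPerfectMatching σ ≡ allᵇ (λ x → occ x (lab σ) ≡ᵇ 2) (lab σ)
isPerfectMatching-occ (k , (t , b)) =
  trans (proj₂ twice k t b _ refl) (foldr-toList (λ x → twice-occ x (t V.++ b)) (t V.++ b))

PerfectMatching⇒Paired : ∀ σ → PerfectMatching σ → Paired (lab σ)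
PerfectMatching⇒Paired σ pm x pos = ≡ᵇ⇒≡ _ 2 (Equivalence.from T-≡
  (allᵇ⇒ _ (lab σ) (trans (sym (isPerfectMatching-occ σ)) (Equivalence.to T-≡ pm)) (occ-pos⇒∈ (lab σ) pos)))

Paired⇒PerfectMatching : ∀ σ → Paired (lab σ) → PerfectMatching σ
Paired⇒PerfectMatching σ paired = Equivalence.from T-≡ (trans (isPerfectMatching-occ σ)
  (allᵇ⇐ _ (lab σ) λ x∈ → Equivalence.to T-≡ (≡⇒≡ᵇ _ 2 (paired _ (∈⇒occ-pos x∈)))))

PairedAt-occ : ∀ xs ys {x y} → occ x xs ≡ occ y ys → PairedAt ys y → PairedAt xs x
PairedAt-occ _ _ same paired pos rewrite same = paired pos

toList-interleave : ∀ {k l} (t₁ b₁ : Vec ℕ k) (t₂ b₂ : Vec ℕ l) (f : ℕ → ℕ) →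
  V.toList ((t₁ V.++ V.map f t₂) V.++ (b₁ V.++ V.map f b₂)) ≡
  (V.toList t₁ ++ L.map f (V.toList t₂)) ++ (V.toList b₁ ++ L.map f (V.toList b₂))
toList-interleave t₁ b₁ t₂ b₂ f
  rewrite toList-++ (t₁ V.++ V.map f t₂) (b₁ V.++ V.map f b₂)
        | toList-++ t₁ (V.map f t₂) | toList-++ b₁ (V.map f b₂)
        | toList-map f t₂ | toList-map f b₂ = refl

occ-map-interleave : ∀ (g : ℕ → ℕ) y (a b c d : List ℕ) →
  occ y (L.map g ((a ++ b) ++ (c ++ d))) ≡ occ y (L.map g (a ++ c)) + occ y (L.map g (b ++ d))
occ-map-interleave g y a b c d
  rewrite map-++ g (a ++ b) (c ++ d) | map-++ g a b | map-++ g c d | map-++ g a c | map-++ g b d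
        | occ-++ y (L.map g a ++ L.map g b) (L.map g c ++ L.map g d)
        | occ-++ y (L.map g a) (L.map g b) | occ-++ y (L.map g c) (L.map g d)
        | occ-++ y (L.map g a) (L.map g c) | occ-++ y (L.map g b) (L.map g d)
  = interchange (occ y (L.map g a)) (occ y (L.map g b)) (occ y (L.map g c)) (occ y (L.map g d))

occ-map-lab-⊗ : ∀ (g : ℕ → ℕ) σ τ y → occ y (L.map g (lab (σ ⊗B τ))) ≡
                occ y (L.map g (lab σ)) + occ y (L.map g (L.map (_+ offset σ) (lab τ)))
occ-map-lab-⊗ g σ@(k , (t₁ , b₁)) (l , (t₂ , b₂)) y
  rewrite toList-interleave t₁ b₁ t₂ b₂ (_+ offset σ)
        | toList-++ t₁ b₁ | toList-++ t₂ b₂ | map-++ (_+ offset σ) (V.toList t₂) (V.toList b₂)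
  = occ-map-interleave g y (V.toList t₁) _ (V.toList b₁) _

occ-lab-⊗ : ∀ σ τ y → occ y (lab (σ ⊗B τ)) ≡ occ y (lab σ) + occ y (L.map (_+ offset σ) (lab τ))
occ-lab-⊗ σ τ y = begin
  occ y (lab (σ ⊗B τ))
    ≡⟨ cong (occ y) (sym (map-id (lab (σ ⊗B τ)))) ⟩
  occ y (L.map id (lab (σ ⊗B τ)))
    ≡⟨ occ-map-lab-⊗ id σ τ y ⟩
  occ y (L.map id (lab σ)) + occ y (L.map id shifted)
    ≡⟨ cong₂ _+_ (cong (occ y) (map-id (lab σ))) (cong (occ y) (map-id shifted)) ⟩
  occ y (lab σ) + occ y shifted ∎
  where
  open ≡-Reasoning
  shifted = L.map (_+ offset σ) (lab τ)

occ-lab-⊗-left : ∀ σ τ {y} → y < offset σ → occ y (lab (σ ⊗B τ)) ≡ occ y (lab σ)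
occ-lab-⊗-left σ τ {y} y<o = begin
  occ y (lab (σ ⊗B τ))                                  ≡⟨ occ-lab-⊗ σ τ y ⟩
  occ y (lab σ) + occ y (L.map (_+ offset σ) (lab τ)) ≡⟨ cong (_ +_) (occ-map-+-< (lab τ) y<o) ⟩
  occ y (lab σ) + 0                                     ≡⟨ +-identityʳ _ ⟩
  occ y (lab σ)                                         ∎
  where open ≡-Reasoning

occ-lab-⊗-right : ∀ σ τ z → occ (z + offset σ) (lab (σ ⊗B τ)) ≡ occ z (lab τ)
occ-lab-⊗-right σ τ z = trans (occ-lab-⊗ σ τ (z + offset σ))
  (cong₂ _+_ (occ-bounded (lab-<-offset σ) (m≤n+m _ z)) (occ-map-+ (offset σ) z (lab τ)))

PerfectMatching-⊗ : ∀ σ τ → PerfectMatching σ → PerfectMatching τ → PerfectMatching (σ ⊗B τ)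
PerfectMatching-⊗ σ τ pmσ pmτ = Paired⇒PerfectMatching (σ ⊗B τ) paired
  where
  paired : Paired (lab (σ ⊗B τ))
  paired x with x <? offset σ
  ... | yes x<o = PairedAt-occ (lab (σ ⊗B τ)) (lab σ) (occ-lab-⊗-left σ τ x<o) (PerfectMatching⇒Paired σ pmσ x)
  ... | no x≮o rewrite sym (m∸n+n≡m (≮⇒≥ x≮o)) =
    PairedAt-occ (lab (σ ⊗B τ)) (lab τ) (occ-lab-⊗-right σ τ (x ∸ offset σ))
      (PerfectMatching⇒Paired τ pmτ (x ∸ offset σ))

PerfectMatching-⊗⁻ : ∀ σ τ → PerfectMatching (σ ⊗B τ) → PerfectMatching σ × PerfectMatching τ
PerfectMatching-⊗⁻ σ τ pm = Paired⇒PerfectMatching σ pairedσ , Paired⇒PerfectMatching τ pairedτ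
  where
  paired = PerfectMatching⇒Paired (σ ⊗B τ) pm
  pairedσ : Paired (lab σ)
  pairedσ x pos = PairedAt-occ (lab σ) (lab (σ ⊗B τ)) (sym (occ-lab-⊗-left σ τ x<o)) (paired x) pos
    where x<o = All.lookup (lab-<-offset σ) (occ-pos⇒∈ (lab σ) pos)
  pairedτ : Paired (lab τ)
  pairedτ z = PairedAt-occ (lab τ) (lab (σ ⊗B τ)) (sym (occ-lab-⊗-right σ τ z)) (paired (z + offset σ))

+≡2⇒≡1 : ∀ {m n} → m + n ≡ 2 → 0 < m → 0 < n → m ≡ 1
+≡2⇒≡1 {suc zero}    _  _ _       = refl
+≡2⇒≡1 {suc (suc m)} {suc n} eq _ _ = ⊥-elim (m+1+n≢0 m (suc-injective (suc-injective eq)))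

module NonemptyBullet {k l} (t₁ b₁ : Vec ℕ (suc k)) (t₂ b₂ : Vec ℕ (suc l)) where
  σ τ : Basis
  σ = suc k , (t₁ , b₁)
  τ = suc l , (t₂ , b₂)

  shift : ℕ → ℕ
  shift = _+ offset σ

  -- the labels of k′ and of (k+1)′ in σ ⊗ τ
  left right : ℕ
  left  = V.last b₁
  right = shift (V.head b₂)

  merge : ℕ → ℕ
  merge x = if x ≡ᵇ right then left else x

  merged : List ℕ
  merged = L.map merge (L.map shift (lab τ))

  lab-• : lab (σ • τ) ≡ L.map merge (lab (σ ⊗B τ))
  lab-• = trans (cong V.toList (sym (VP.map-++ merge (proj₁ (proj₂ (σ ⊗B τ))) _))) (toList-map merge _)

  map-merge-below : ∀ {xs} → All (_< right) xs → L.map merge xs ≡ xs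
  map-merge-below []                = refl
  map-merge-below (x<right ∷ xs<right) rewrite ≢⇒≡ᵇ-false (<⇒≢ x<right) =
    cong (_ ∷_) (map-merge-below xs<right)

  occ-lab-• : ∀ y → occ y (lab (σ • τ)) ≡ occ y (lab σ) + occ y merged
  occ-lab-• y = begin
    occ y (lab (σ • τ))                                    ≡⟨ cong (occ y) lab-• ⟩
    occ y (L.map merge (lab (σ ⊗B τ)))                     ≡⟨ occ-map-lab-⊗ merge σ τ y ⟩
    occ y (L.map merge (lab σ)) + occ y merged             ≡⟨ cong (λ xs → occ y xs + occ y merged) σ-unmerged ⟩
    occ y (lab σ) + occ y merged                           ∎
    where
    open ≡-Reasoning
    σ-unmerged = map-merge-below (All.map (λ x<o → ≤-trans x<o (m≤n+m _ (V.head b₂))) (lab-<-offset σ))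

  occ-merged-below : ∀ {y} → y < offset σ → y ≢ left → ∀ xs → occ y (L.map merge (L.map shift xs)) ≡ 0
  occ-merged-below y<o y≢left []       = refl
  occ-merged-below {y} y<o y≢left (z ∷ zs) with shift z ≡ᵇ right
  ... | true  rewrite ≢⇒≡ᵇ-false y≢left = occ-merged-below y<o y≢left zs
  ... | false rewrite ≢⇒≡ᵇ-false {y} {shift z} (<⇒≢ (≤-trans y<o (m≤n+m _ z))) =
    occ-merged-below y<o y≢left zs

  left-∈-merged : 0 < occ left merged
  left-∈-merged = ∈⇒occ-pos (subst (_∈ merged) merge-right (∈-map⁺ merge (∈-map⁺ shift head∈)))
    where
    head∈ : V.head b₂ ∈ lab τ
    head∈ = subst (V.head b₂ ∈_) (sym (toList-++ t₂ b₂)) (∈-++⁺ʳ (V.toList t₂) (head-∈ b₂))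
      where
      head-∈ : ∀ {n} (v : Vec ℕ (suc n)) → V.head v ∈ V.toList v
      head-∈ (x ∷ v) = here refl
    merge-right : merge right ≡ left
    merge-right rewrite ≡ᵇ-refl right = refl

  left-∈-lab : 0 < occ left (lab σ)
  left-∈-lab = ∈⇒occ-pos (subst (left ∈_) (sym (toList-++ t₁ b₁)) (∈-++⁺ʳ (V.toList t₁) (last-∈ b₁)))
    where
    last-∈ : ∀ {n} (v : Vec ℕ (suc n)) → V.last v ∈ V.toList v
    last-∈ (x ∷ [])     = here refl
    last-∈ (x ∷ y ∷ v) = there (last-∈ (y ∷ v))

  -- k′ is alone in its block of σ, so adding one more copy of its label pairs up
  -- the labels of σ, whose number is even.
  ¬PerfectMatching : ¬ PerfectMatching (σ • τ)
  ¬PerfectMatching pm = even≢odd m (suc k) (begin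
      2 ℕ.* m                      ≡⟨ sym length≡ ⟩
      suc (L.length (lab σ))       ≡⟨ cong suc (length-toList (t₁ V.++ b₁)) ⟩
      suc (suc k + suc k)          ≡⟨ cong (λ n → suc (suc k + n)) (sym (+-identityʳ (suc k))) ⟩
      suc (2 ℕ.* suc k)            ∎)
    where
    open ≡-Reasoning
    paired• = PerfectMatching⇒Paired (σ • τ) pm

    left-once : occ left (lab σ) ≡ 1
    left-once = +≡2⇒≡1 (trans (sym (occ-lab-• left)) (paired• left pos)) left-∈-lab left-∈-merged
      where pos = subst (0 <_) (sym (occ-lab-• left)) (≤-trans left-∈-merged (m≤n+m _ _))

    paired : Paired (left ∷ lab σ)
    paired y with y ≟ left
    ... | yes refl = λ _ → trans (occ-∷-self left (lab σ)) (cong suc left-once)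
    ... | no y≢left rewrite ≢⇒≡ᵇ-false y≢left = λ pos →
      let y<o = All.lookup (lab-<-offset σ) (occ-pos⇒∈ (lab σ) pos)
          same = trans (occ-lab-• y) (trans (cong (_ +_) (occ-merged-below y<o y≢left (lab τ))) (+-identityʳ _))
      in PairedAt-occ (lab σ) (lab (σ • τ)) (sym same) (paired• y) pos

    even = Paired⇒even-length (left ∷ lab σ) paired
    m = proj₁ even
    length≡ = proj₂ even

PerfectMatching-•⁻ : ∀ σ τ → PerfectMatching (σ • τ) → PerfectMatching σ × PerfectMatching τ
PerfectMatching-•⁻ (zero , ([] , []))   τ                    pm = tt , pm
PerfectMatching-•⁻ (suc k , π)          (zero , ([] , []))   pm = pm , tt
PerfectMatching-•⁻ (suc k , (t₁ , b₁)) (suc l , (t₂ , b₂)) pm =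
  ⊥-elim (NonemptyBullet.¬PerfectMatching t₁ b₁ t₂ b₂ pm)

PerfectMatching-bulletAll⁻ : ∀ ρs → PerfectMatching (bulletAll ρs) → All PerfectMatching ρs
PerfectMatching-bulletAll⁻ []       _  = []
PerfectMatching-bulletAll⁻ (ρ ∷ ρs) pm =
  let pmρ , pmρs = PerfectMatching-•⁻ ρ (bulletAll ρs) pm in pmρ ∷ PerfectMatching-bulletAll⁻ ρs pmρs

-- Equality of diagrams

iff : Bool → Bool → Bool
iff true  y = y
iff false y = not y

iff⇒≡ : ∀ x y → iff x y ≡ true → x ≡ y
iff⇒≡ true  true  _ = refl
iff⇒≡ false false _ = refl

iff-refl : ∀ x → iff x x ≡ true
iff-refl true  = refl
iff-refl false = refl

linked : ∀ {k} → Diagram k → Fin (k + k) → Fin (k + k) → Bool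
linked π i j = V.lookup (labels π) i ≡ᵇ V.lookup (labels π) j

SameBlocks : ∀ {k} → Diagram k → Diagram k → Set
SameBlocks π ρ = ∀ i j → linked π i j ≡ linked ρ i j

-- The test inside `sameD` is recovered like those of `isPerfectMatching`.
private
  PairTest : Set
  PairTest = ∀ {k} → Diagram k → Diagram k → Fin (k + k) → Fin (k + k) → Bool → Bool

  Unfolds₂ : PairTest → Set
  Unfolds₂ test = ∀ k (π ρ : Diagram k) →
    sameD π ρ ≡ L.foldr (λ i acc → L.foldr (test π ρ i) true (allFin (k + k)) ∧ acc) true (allFin (k + k))

  sameTest : Σ PairTest Unfolds₂
  sameTest = _ , unfold
    where
    unfold : Unfolds₂ _
    unfold k π ρ = refl

  sameTest-iff : ∀ {k} (π ρ : Diagram k) i j acc →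
                 proj₁ sameTest π ρ i j acc ≡ (iff (linked π i j) (linked ρ i j) ∧ acc)
  sameTest-iff π ρ i j acc with linked π i j
  ... | true  = refl
  ... | false = refl

sameD-allᵇ : ∀ {k} (π ρ : Diagram k) →
  sameD π ρ ≡ allᵇ (λ i → allᵇ (λ j → iff (linked π i j) (linked ρ i j)) (allFin (k + k))) (allFin (k + k))
sameD-allᵇ {k} π ρ = trans (proj₂ sameTest k π ρ)
  (foldr-cong (λ i acc → cong (_∧ acc) (foldr-cong (sameTest-iff π ρ i) refl (allFin (k + k)))) refl (allFin (k + k)))

sameD⇒SameBlocks : ∀ {k} (π ρ : Diagram k) → sameD π ρ ≡ true → SameBlocks π ρ
sameD⇒SameBlocks {k} π ρ same i j = iff⇒≡ _ _
  (allᵇ⇒ _ (allFin (k + k)) (allᵇ⇒ _ (allFin (k + k)) (trans (sym (sameD-allᵇ π ρ)) same) (∈-allFin i)) (∈-allFin j))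

SameBlocks⇒sameD : ∀ {k} (π ρ : Diagram k) → SameBlocks π ρ → sameD π ρ ≡ true
SameBlocks⇒sameD {k} π ρ same = trans (sameD-allᵇ π ρ)
  (allᵇ⇐ _ (allFin (k + k)) λ {i} _ → allᵇ⇐ _ (allFin (k + k)) λ {j} _ →
    subst (λ b → iff (linked π i j) b ≡ true) (same i j) (iff-refl (linked π i j)))

infix 4 _≈ᴰ_
record _≈ᴰ_ (σ τ : Basis) : Set where
  constructor mk≈ᴰ
  field sameB≡true : sameB σ τ ≡ true
open _≈ᴰ_

sameB-sameD : ∀ k (π ρ : Diagram k) → sameB (k , π) (k , ρ) ≡ sameD π ρ
sameB-sameD k π ρ with k ≟ k
... | yes refl = refl
... | no k≢k   = ⊥-elim (k≢k refl)

≈ᴰ-order : ∀ {σ τ} → σ ≈ᴰ τ → order σ ≡ order τ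
≈ᴰ-order {k , _} {l , _} (mk≈ᴰ same) with k ≟ l
... | yes k≡l = k≡l

≈ᴰ⇒SameBlocks : ∀ {k} (π ρ : Diagram k) → (k , π) ≈ᴰ (k , ρ) → SameBlocks π ρ
≈ᴰ⇒SameBlocks {k} π ρ (mk≈ᴰ same) = sameD⇒SameBlocks π ρ (trans (sym (sameB-sameD k π ρ)) same)

SameBlocks⇒≈ᴰ : ∀ {k} (π ρ : Diagram k) → SameBlocks π ρ → (k , π) ≈ᴰ (k , ρ)
SameBlocks⇒≈ᴰ {k} π ρ same = mk≈ᴰ (trans (sameB-sameD k π ρ) (SameBlocks⇒sameD π ρ same))

≈ᴰ-refl : ∀ σ → σ ≈ᴰ σ
≈ᴰ-refl (k , π) = SameBlocks⇒≈ᴰ π π λ i j → refl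

≈ᴰ-sym : ∀ {σ τ} → σ ≈ᴰ τ → τ ≈ᴰ σ
≈ᴰ-sym {k , π} {l , ρ} same with ≈ᴰ-order same
... | refl = SameBlocks⇒≈ᴰ ρ π λ i j → sym (≈ᴰ⇒SameBlocks π ρ same i j)

≈ᴰ-trans : ∀ {σ τ υ} → σ ≈ᴰ τ → τ ≈ᴰ υ → σ ≈ᴰ υ
≈ᴰ-trans {k , π} {l , ρ} {m , υ} s₁ s₂ with ≈ᴰ-order s₁ | ≈ᴰ-order s₂
... | refl | refl =
  SameBlocks⇒≈ᴰ π υ λ i j → trans (≈ᴰ⇒SameBlocks π ρ s₁ i j) (≈ᴰ⇒SameBlocks ρ υ s₂ i j)

sameB-respʳ : ∀ σ {τ τ′} → τ ≈ᴰ τ′ → sameB σ τ ≡ sameB σ τ′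
sameB-respʳ σ same = ⇔→≡ {z = true} (mk⇔
  (λ s → sameB≡true (≈ᴰ-trans (mk≈ᴰ {σ} s) same))
  (λ s → sameB≡true (≈ᴰ-trans (mk≈ᴰ {σ} s) (≈ᴰ-sym same))))

sameB-respˡ : ∀ {σ σ′} τ → σ ≈ᴰ σ′ → sameB σ τ ≡ sameB σ′ τ
sameB-respˡ {σ} {σ′} τ same = ⇔→≡ {z = true} (mk⇔
  (λ s → sameB≡true (≈ᴰ-trans (≈ᴰ-sym same) (mk≈ᴰ {σ} {τ} s)))
  (λ s → sameB≡true (≈ᴰ-trans same (mk≈ᴰ {σ′} {τ} s))))

pairs : ∀ {n} → Vec ℕ n → Vec ℕ n → List (ℕ × ℕ)
pairs []      []      = []
pairs (x ∷ v) (y ∷ w) = (x , y) ∷ pairs v w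

pairs-lookup : ∀ {n} (v w : Vec ℕ n) i → (V.lookup v i , V.lookup w i) ∈ pairs v w
pairs-lookup (x ∷ v) (y ∷ w) Fin.zero    = here refl
pairs-lookup (x ∷ v) (y ∷ w) (Fin.suc i) = there (pairs-lookup v w i)

∈-pairs⇒lookup : ∀ {n} (v w : Vec ℕ n) {p} → p ∈ pairs v w → ∃ λ i → p ≡ (V.lookup v i , V.lookup w i)
∈-pairs⇒lookup []      []      ()
∈-pairs⇒lookup (x ∷ v) (y ∷ w) (here refl) = Fin.zero , refl
∈-pairs⇒lookup (x ∷ v) (y ∷ w) (there p∈)  = let i , p≡ = ∈-pairs⇒lookup v w p∈ in Fin.suc i , p≡

∈-pairs⇒∈ : ∀ {n} (v w : Vec ℕ n) {p} → p ∈ pairs v w → proj₁ p ∈ V.toList v × proj₂ p ∈ V.toList w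
∈-pairs⇒∈ []      []      ()
∈-pairs⇒∈ (x ∷ v) (y ∷ w) (here refl) = here refl , here refl
∈-pairs⇒∈ (x ∷ v) (y ∷ w) (there p∈)  = let x∈ , y∈ = ∈-pairs⇒∈ v w p∈ in there x∈ , there y∈

∈⇒∈-pairs : ∀ {n} (v w : Vec ℕ n) {y} → y ∈ V.toList w → ∃ λ x → (x , y) ∈ pairs v w
∈⇒∈-pairs (x ∷ v) (y ∷ w) (here refl) = x , here refl
∈⇒∈-pairs (x ∷ v) (y ∷ w) (there y∈)  = let x′ , p∈ = ∈⇒∈-pairs v w y∈ in x′ , there p∈

map-proj₁-pairs : ∀ {n} (v w : Vec ℕ n) → L.map proj₁ (pairs v w) ≡ V.toList v
map-proj₁-pairs []      []      = refl
map-proj₁-pairs (x ∷ v) (y ∷ w) = cong (x ∷_) (map-proj₁-pairs v w)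

map-proj₂-pairs : ∀ {n} (v w : Vec ℕ n) → L.map proj₂ (pairs v w) ≡ V.toList w
map-proj₂-pairs []      []      = refl
map-proj₂-pairs (x ∷ v) (y ∷ w) = cong (y ∷_) (map-proj₂-pairs v w)

pairs-++ : ∀ {m n} (a c : Vec ℕ m) (b d : Vec ℕ n) → pairs (a V.++ b) (c V.++ d) ≡ pairs a c ++ pairs b d
pairs-++ []      []      b d = refl
pairs-++ (x ∷ a) (y ∷ c) b d = cong ((x , y) ∷_) (pairs-++ a c b d)

pairs-map : ∀ {n} (f g : ℕ → ℕ) (a c : Vec ℕ n) →
            pairs (V.map f a) (V.map g c) ≡ L.map (λ p → f (proj₁ p) , g (proj₂ p)) (pairs a c)
pairs-map f g []      []      = refl
pairs-map f g (x ∷ a) (y ∷ c) = cong ((f x , g y) ∷_) (pairs-map f g a c)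

-- The graph of a bijection between two sets of labels.
Relabelling : List (ℕ × ℕ) → Set
Relabelling Z = ∀ {p q} → p ∈ Z → q ∈ Z → (proj₁ p ≡ᵇ proj₁ q) ≡ (proj₂ p ≡ᵇ proj₂ q)

SameBlocks⇒Relabelling : ∀ {k} (π ρ : Diagram k) → SameBlocks π ρ → Relabelling (pairs (labels π) (labels ρ))
SameBlocks⇒Relabelling π ρ same p∈ q∈
  with ∈-pairs⇒lookup (labels π) (labels ρ) p∈ | ∈-pairs⇒lookup (labels π) (labels ρ) q∈
... | i , refl | j , refl = same i j

Relabelling⇒SameBlocks : ∀ {k} (π ρ : Diagram k) → Relabelling (pairs (labels π) (labels ρ)) → SameBlocks π ρ
Relabelling⇒SameBlocks π ρ relabel i j =
  relabel (pairs-lookup (labels π) (labels ρ) i) (pairs-lookup (labels π) (labels ρ) j)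

Relabelling-⊆ : ∀ {Z Z′} → (∀ {p} → p ∈ Z → p ∈ Z′) → Relabelling Z′ → Relabelling Z
Relabelling-⊆ Z⊆Z′ relabel p∈ q∈ = relabel (Z⊆Z′ p∈) (Z⊆Z′ q∈)

Relabelling-++-shift : ∀ o o′ {A B} → All (λ p → proj₁ p < o × proj₂ p < o′) A →
  Relabelling A → Relabelling B → Relabelling (A ++ L.map (λ p → proj₁ p + o , proj₂ p + o′) B)
Relabelling-++-shift o o′ {A} {B} A<o relabelA relabelB = relabel
  where
  shift = λ (p : ℕ × ℕ) → proj₁ p + o , proj₂ p + o′

  apart : ∀ {p q} → p ∈ A → q ∈ B → (proj₁ p ≡ᵇ proj₁ (shift q)) ≡ (proj₂ p ≡ᵇ proj₂ (shift q))
  apart {p} {q} p∈ _ = let p₁<o , p₂<o′ = All.lookup A<o p∈ in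
    trans (≢⇒≡ᵇ-false (<⇒≢ (≤-trans p₁<o (m≤n+m o (proj₁ q)))))
          (sym (≢⇒≡ᵇ-false (<⇒≢ (≤-trans p₂<o′ (m≤n+m o′ (proj₂ q))))))

  relabel : Relabelling (A ++ L.map shift B)
  relabel {p} {q} p∈ q∈ with ∈-++⁻ A p∈ | ∈-++⁻ A q∈
  ... | inj₁ p∈A | inj₁ q∈A = relabelA p∈A q∈A
  ... | inj₁ p∈A | inj₂ q∈B with ∈-map⁻ shift q∈B
  ...   | q′ , q′∈ , refl = apart p∈A q′∈
  relabel {p} {q} p∈ q∈ | inj₂ p∈B | inj₁ q∈A with ∈-map⁻ shift p∈B
  ...   | p′ , p′∈ , refl =
    trans (≡ᵇ-sym (proj₁ (shift p′)) (proj₁ q)) (trans (apart q∈A p′∈) (≡ᵇ-sym (proj₂ q) (proj₂ (shift p′))))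
  relabel {p} {q} p∈ q∈ | inj₂ p∈B | inj₂ q∈B with ∈-map⁻ shift p∈B | ∈-map⁻ shift q∈B
  ...   | p′ , p′∈ , refl | q′ , q′∈ , refl =
    trans (≡ᵇ-+-cancelʳ o (proj₁ p′) (proj₁ q′))
          (trans (relabelB p′∈ q′∈) (sym (≡ᵇ-+-cancelʳ o′ (proj₂ p′) (proj₂ q′))))

PerfectMatching-≈ᴰ : ∀ {σ τ} → σ ≈ᴰ τ → PerfectMatching σ → PerfectMatching τ
PerfectMatching-≈ᴰ {k , π} {l , ρ} same pm with ≈ᴰ-order same
... | refl = Paired⇒PerfectMatching (k , ρ) paired
  where
  Z = pairs (labels π) (labels ρ)
  relabel = SameBlocks⇒Relabelling π ρ (≈ᴰ⇒SameBlocks π ρ same)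

  paired : Paired (lab (k , ρ))
  paired y pos = PairedAt-occ (lab (k , ρ)) (lab (k , π)) (sym same-occ) (PerfectMatching⇒Paired (k , π) pm x) pos
    where
    partner = ∈⇒∈-pairs (labels π) (labels ρ) (occ-pos⇒∈ (lab (k , ρ)) pos)
    x = proj₁ partner
    same-occ : occ x (lab (k , π)) ≡ occ y (lab (k , ρ))
    same-occ = subst₂ (λ xs ys → occ x xs ≡ occ y ys) (map-proj₁-pairs (labels π) (labels ρ))
      (map-proj₂-pairs (labels π) (labels ρ)) (occ-map proj₁ proj₂ x y Z (relabel (proj₂ partner)))

∈-interleave : ∀ {A : Set} (h : A → A) a b c d {x} →
               x ∈ (a ++ L.map h b) ++ (c ++ L.map h d) → x ∈ (a ++ c) ++ L.map h (b ++ d)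
∈-interleave h a b c d x∈ rewrite map-++ h b d with ∈-++⁻ (a ++ L.map h b) x∈
... | inj₁ x∈ab with ∈-++⁻ a x∈ab
...   | inj₁ x∈a  = ∈-++⁺ˡ (∈-++⁺ˡ x∈a)
...   | inj₂ x∈hb = ∈-++⁺ʳ (a ++ c) (∈-++⁺ˡ x∈hb)
∈-interleave h a b c d x∈ | inj₂ x∈cd with ∈-++⁻ c x∈cd
...   | inj₁ x∈c  = ∈-++⁺ˡ (∈-++⁺ʳ a x∈c)
...   | inj₂ x∈hd = ∈-++⁺ʳ (a ++ c) (∈-++⁺ʳ (L.map h b) x∈hd)

⊗-resp-≈ᴰ : ∀ {σ σ′ τ τ′} → σ ≈ᴰ σ′ → τ ≈ᴰ τ′ → σ ⊗B τ ≈ᴰ σ′ ⊗B τ′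
⊗-resp-≈ᴰ {σ@(k , π@(t₁ , b₁))} {σ′@(k′ , π′@(t₁′ , b₁′))} {τ@(l , ρ@(t₂ , b₂))} {τ′@(l′ , ρ′@(t₂′ , b₂′))}
          sameσ sameτ
  with ≈ᴰ-order sameσ | ≈ᴰ-order sameτ
... | refl | refl =
  SameBlocks⇒≈ᴰ π⊗ρ π′⊗ρ′ (Relabelling⇒SameBlocks π⊗ρ π′⊗ρ′ (Relabelling-⊆ ⊆shifted
    (Relabelling-++-shift o o′ bounded
      (SameBlocks⇒Relabelling π π′ (≈ᴰ⇒SameBlocks π π′ sameσ))
      (SameBlocks⇒Relabelling ρ ρ′ (≈ᴰ⇒SameBlocks ρ ρ′ sameτ)))))
  where
  o  = offset σ
  o′ = offset σ′
  shift = λ (p : ℕ × ℕ) → proj₁ p + o , proj₂ p + o′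
  π⊗ρ   = proj₂ (σ ⊗B τ)
  π′⊗ρ′ = proj₂ (σ′ ⊗B τ′)

  bounded : All (λ p → proj₁ p < o × proj₂ p < o′) (pairs (labels π) (labels π′))
  bounded = All.tabulate λ p∈ → let p₁∈ , p₂∈ = ∈-pairs⇒∈ (labels π) (labels π′) p∈ in
    All.lookup (lab-<-offset σ) p₁∈ , All.lookup (lab-<-offset σ′) p₂∈

  ⊆shifted : ∀ {p} → p ∈ pairs (labels π⊗ρ) (labels π′⊗ρ′) →
             p ∈ pairs (labels π) (labels π′) ++ L.map shift (pairs (labels ρ) (labels ρ′))
  ⊆shifted p∈
    rewrite pairs-++ t₁ t₁′ b₁ b₁′ | pairs-++ t₂ t₂′ b₂ b₂′
          | pairs-++ (t₁ V.++ V.map (_+ o) t₂) (t₁′ V.++ V.map (_+ o′) t₂′)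
                     (b₁ V.++ V.map (_+ o) b₂) (b₁′ V.++ V.map (_+ o′) b₂′)
          | pairs-++ t₁ t₁′ (V.map (_+ o) t₂) (V.map (_+ o′) t₂′)
          | pairs-++ b₁ b₁′ (V.map (_+ o) b₂) (V.map (_+ o′) b₂′)
          | pairs-map (_+ o) (_+ o′) t₂ t₂′ | pairs-map (_+ o) (_+ o′) b₂ b₂′
    = ∈-interleave shift (pairs t₁ t₁′) (pairs t₂ t₂′) (pairs b₁ b₁′) (pairs b₂ b₂′) p∈

-- Formal linear combinations

module Combinations {c ℓ} (R : CommutativeRing c ℓ) where
  private module R = CommutativeRing R
  open R using (Carrier; _≈_; _*_; -_; 0#; 1#) renaming (_+_ to _⊕_)
  open import Relation.Binary.Reasoning.Setoid R.setoid

  eval : ∀ {X : Set} → (X → Carrier) → List (Carrier × X) → Carrier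
  eval w []            = 0#
  eval w ((a , x) ∷ z) = a * w x ⊕ eval w z

  eval-++ : ∀ {X : Set} (w : X → Carrier) z z′ → eval w (z ++ z′) ≈ eval w z ⊕ eval w z′
  eval-++ w []      z′ = R.sym (R.+-identityˡ _)
  eval-++ w (p ∷ z) z′ = R.trans (R.+-congˡ (eval-++ w z z′)) (R.sym (R.+-assoc _ _ _))

  eval-cong : ∀ {X : Set} {w w′ : X → Carrier} → (∀ x → w x ≈ w′ x) → ∀ z → eval w z ≈ eval w′ z
  eval-cong same []            = R.refl
  eval-cong same ((a , x) ∷ z) = R.+-cong (R.*-congˡ (same x)) (eval-cong same z)

  eval-*ʳ : ∀ {X : Set} (w : X → Carrier) s z → eval (λ x → w x * s) z ≈ eval w z * s
  eval-*ʳ w s []            = R.sym (R.zeroˡ s)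
  eval-*ʳ w s ((a , x) ∷ z) = R.trans (R.+-cong (R.sym (R.*-assoc _ _ _)) (eval-*ʳ w s z)) (R.sym (R.distribʳ s _ _))

  eval-scale-map : ∀ {X Y : Set} (w : Y → Carrier) s (h : X → Y) z →
    eval w (L.map (λ q → s * proj₁ q , h (proj₂ q)) z) ≈ s * eval (w ∘ h) z
  eval-scale-map w s h []            = R.sym (R.zeroʳ s)
  eval-scale-map w s h ((a , x) ∷ z) = begin
    s * a * w (h x) ⊕ eval w (L.map (λ q → s * proj₁ q , h (proj₂ q)) z)
      ≈⟨ R.+-cong (R.*-assoc s a (w (h x))) (eval-scale-map w s h z) ⟩
    s * (a * w (h x)) ⊕ s * eval (w ∘ h) z
      ≈⟨ R.sym (R.distribˡ s _ _) ⟩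
    s * eval (w ∘ h) ((a , x) ∷ z) ∎

  -- the shape shared by the products of ParSym and of its tensor square, Δ and S
  bind : ∀ {X Y Z : Set} → (X → List (Carrier × Z)) → (X → Z → Y) → List (Carrier × X) → List (Carrier × Y)
  bind G h = L.concatMap (λ p → L.map (λ q → proj₁ p * proj₁ q , h (proj₂ p) (proj₂ q)) (G (proj₂ p)))

  eval-bind : ∀ {X Y Z : Set} (w : Y → Carrier) (G : X → List (Carrier × Z)) (h : X → Z → Y) z →
              eval w (bind G h z) ≈ eval (λ x → eval (w ∘ h x) (G x)) z
  eval-bind w G h []            = R.refl
  eval-bind w G h ((a , x) ∷ z) =
    R.trans (eval-++ w (L.map (λ q → a * proj₁ q , h x (proj₂ q)) (G x)) _)
            (R.+-cong (eval-scale-map w a (h x) (G x)) (eval-bind w G h z))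

  All-bind : ∀ {X Y Z : Set} {P : X → Set} {Q : Z → Set} {S : Y → Set}
             (G : X → List (Carrier × Z)) (h : X → Z → Y) →
             (∀ {x z} → P x → Q z → S (h x z)) → (∀ {x} → P x → All (Q ∘ proj₂) (G x)) →
             ∀ {z} → All (P ∘ proj₂) z → All (S ∘ proj₂) (bind G h z)
  All-bind G h combine supported []        = []
  All-bind G h combine supported (px ∷ pz) =
    All.++⁺ (All.map⁺ (All.map (combine px) (supported px))) (All-bind G h combine supported pz)

  negate : ∀ {X : Set} → List (Carrier × X) → List (Carrier × X)
  negate = L.map (λ q → - 1# * proj₁ q , proj₂ q)

  eval-difference : ∀ {X : Set} (w : X → Carrier) z z′ → eval w (z ++ negate z′) ≈ eval w z ⊕ - eval w z′
  eval-difference w z z′ =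
    R.trans (eval-++ w z (negate z′)) (R.+-congˡ (R.trans (eval-scale-map w (- 1#) id z′) (-1*x≈-x _)))
    where open import Algebra.Properties.Ring R.ring using (-1*x≈-x)

  select : ∀ {X : Set} → (X → Bool) → List (Carrier × X) → List (Carrier × X)
  select P []            = []
  select P ((a , x) ∷ z) = if P x then (a , x) ∷ select P z else select P z

  length-select : ∀ {X : Set} (P : X → Bool) z → L.length (select P z) ≤ L.length z
  length-select P []            = z≤n
  length-select P ((a , x) ∷ z) with P x
  ... | true  = s≤s (length-select P z)
  ... | false = m≤n⇒m≤1+n (length-select P z)

  eval-select-split : ∀ {X : Set} (P : X → Bool) w z →
    eval w z ≈ eval w (select P z) ⊕ eval w (select (not ∘ P) z)
  eval-select-split P w []            = R.sym (R.+-identityˡ 0#)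
  eval-select-split P w ((a , x) ∷ z) with P x
  ... | true  = R.trans (R.+-congˡ (eval-select-split P w z)) (R.sym (R.+-assoc _ _ _))
  ... | false = R.trans (R.+-congˡ (eval-select-split P w z)) (x∙yz≈y∙xz _ _ _)
    where open import Algebra.Properties.CommutativeSemigroup R.+-commutativeSemigroup using (x∙yz≈y∙xz)

  eval-select-cong : ∀ {X : Set} (P : X → Bool) {w w′ : X → Carrier} →
    (∀ x → P x ≡ true → w x ≈ w′ x) → ∀ z → eval w (select P z) ≈ eval w′ (select P z)
  eval-select-cong P same []            = R.refl
  eval-select-cong P same ((a , x) ∷ z) with P x in Px
  ... | true  = R.+-cong (R.*-congˡ (same x Px)) (eval-select-cong P same z)
  ... | false = eval-select-cong P same z

  eval-select-zero : ∀ {X : Set} (P : X → Bool) {w : X → Carrier} →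
    (∀ x → P x ≡ true → w x ≈ 0#) → ∀ z → eval w (select P z) ≈ 0#
  eval-select-zero P {w} vanish z = R.trans (eval-select-cong P vanish z) (eval-zero (select P z))
    where
    eval-zero : ∀ z → eval (λ _ → 0#) z ≈ 0#
    eval-zero []            = R.refl
    eval-zero ((a , x) ∷ z) = R.trans (R.+-cong (R.zeroʳ a) (eval-zero z)) (R.+-identityˡ 0#)

module Coefficients {c ℓ} (F : Field c ℓ) where
  open ParSym F
  private module 𝔽 = Field F
  open 𝔽 using (Carrier; _≈_; _*_; -_; 0#; 1#) renaming (_+_ to _⊕_)
  open Combinations 𝔽.commutativeRing public
  open import Relation.Binary.Reasoning.Setoid 𝔽.setoid

  indicator : Basis → Basis → Carrier
  indicator π σ = if sameB σ π then 1# else 0#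

  indicator₂ : Basis → Basis → Basis × Basis → Carrier
  indicator₂ π ρ g = if sameB (proj₁ g) π ∧ sameB (proj₂ g) ρ then 1# else 0#

  coeff≈eval : ∀ x π → coeff x π ≈ eval (indicator π) x
  coeff≈eval []            π = 𝔽.refl
  coeff≈eval ((a , σ) ∷ x) π with sameB σ π
  ... | true  = 𝔽.+-cong (𝔽.sym (𝔽.*-identityʳ a)) (coeff≈eval x π)
  ... | false = 𝔽.trans (coeff≈eval x π) (𝔽.sym (𝔽.trans (𝔽.+-congʳ (𝔽.zeroʳ a)) (𝔽.+-identityˡ _)))

  coeff₂≈eval : ∀ z π ρ → coeff₂ z π ρ ≈ eval (indicator₂ π ρ) z
  coeff₂≈eval []                  π ρ = 𝔽.refl
  coeff₂≈eval ((a , σ , τ) ∷ z) π ρ with sameB σ π ∧ sameB τ ρ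
  ... | true  = 𝔽.+-cong (𝔽.sym (𝔽.*-identityʳ a)) (coeff₂≈eval z π ρ)
  ... | false = 𝔽.trans (coeff₂≈eval z π ρ) (𝔽.sym (𝔽.trans (𝔽.+-congʳ (𝔽.zeroʳ a)) (𝔽.+-identityˡ _)))

  Invariant : (Basis → Carrier) → Set ℓ
  Invariant Φ = ∀ {σ τ} → σ ≈ᴰ τ → Φ σ ≈ Φ τ

  CoeffZero : ParSym → Set ℓ
  CoeffZero x = ∀ π → coeff x π ≈ 0#

  inClass : Basis → Basis → Bool
  inClass σ τ = sameB τ σ

  class rest : Basis → ParSym → ParSym
  class σ = select (inClass σ)
  rest  σ = select (not ∘ inClass σ)

  indicator-outside : ∀ {π τ} → sameB τ π ≡ false → indicator π τ ≈ 0#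
  indicator-outside τ∉π rewrite τ∉π = 𝔽.refl

  not≡true : ∀ {b} → not b ≡ true → b ≡ false
  not≡true {false} _ = refl

  coeff≈eval-class : ∀ σ x → coeff x σ ≈ eval (indicator σ) (class σ x)
  coeff≈eval-class σ x = begin
    coeff x σ                                                      ≈⟨ coeff≈eval x σ ⟩
    eval (indicator σ) x                                           ≈⟨ eval-select-split (inClass σ) (indicator σ) x ⟩
    eval (indicator σ) (class σ x) ⊕ eval (indicator σ) (rest σ x) ≈⟨ 𝔽.+-congˡ rest≈0 ⟩
    eval (indicator σ) (class σ x) ⊕ 0#                            ≈⟨ 𝔽.+-identityʳ _ ⟩
    eval (indicator σ) (class σ x)                                 ∎
    where
    rest≈0 = eval-select-zero (not ∘ inClass σ) (λ τ τ∉σ → indicator-outside {σ} {τ} (not≡true τ∉σ)) x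

  eval-class : ∀ {Φ} → Invariant Φ → ∀ σ x → eval Φ (class σ x) ≈ coeff x σ * Φ σ
  eval-class {Φ} invariant σ x = begin
    eval Φ (class σ x)                   ≈⟨ eval-select-cong (inClass σ) constant x ⟩
    eval (λ _ → 1# * Φ σ) (class σ x)    ≈⟨ eval-*ʳ (λ _ → 1#) (Φ σ) (class σ x) ⟩
    eval (λ _ → 1#) (class σ x) * Φ σ    ≈⟨ 𝔽.*-congʳ (eval-select-cong (inClass σ) one x) ⟩
    eval (indicator σ) (class σ x) * Φ σ ≈⟨ 𝔽.*-congʳ (𝔽.sym (coeff≈eval-class σ x)) ⟩
    coeff x σ * Φ σ                      ∎
    where
    constant : ∀ τ → inClass σ τ ≡ true → Φ τ ≈ 1# * Φ σ
    constant τ τ∈σ = 𝔽.trans (invariant (mk≈ᴰ {τ} {σ} τ∈σ)) (𝔽.sym (𝔽.*-identityˡ _))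
    one : ∀ τ → inClass σ τ ≡ true → 1# ≈ indicator σ τ
    one τ τ∈σ rewrite τ∈σ = 𝔽.refl

  CoeffZero-rest : ∀ σ x → CoeffZero x → CoeffZero (rest σ x)
  CoeffZero-rest σ x vanish π with sameB σ π in σπ
  ... | true = 𝔽.trans (coeff≈eval (rest σ x) π) (eval-select-zero (not ∘ inClass σ) outside x)
    where
    outside : ∀ τ → not (inClass σ τ) ≡ true → indicator π τ ≈ 0#
    outside τ τ∉σ = indicator-outside {π} {τ} (trans (sym (sameB-respʳ τ (mk≈ᴰ {σ} {π} σπ))) (not≡true τ∉σ))
  ... | false = begin
    coeff (rest σ x) π                                              ≈⟨ coeff≈eval (rest σ x) π ⟩
    eval (indicator π) (rest σ x)                                   ≈⟨ 𝔽.sym (𝔽.+-identityˡ _) ⟩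
    0# ⊕ eval (indicator π) (rest σ x)                              ≈⟨ 𝔽.+-congʳ (𝔽.sym class≈0) ⟩
    eval (indicator π) (class σ x) ⊕ eval (indicator π) (rest σ x) ≈⟨ 𝔽.sym (eval-select-split (inClass σ) (indicator π) x) ⟩
    eval (indicator π) x                                            ≈⟨ 𝔽.sym (coeff≈eval x π) ⟩
    coeff x π                                                       ≈⟨ vanish π ⟩
    0#                                                              ∎
    where
    class≈0 = eval-select-zero (inClass σ)
      (λ τ τ∈σ → indicator-outside {π} {τ} (trans (sameB-respˡ π (mk≈ᴰ {τ} {σ} τ∈σ)) σπ)) x

  -- Split off the class of the first diagram: by invariance it contributes coeff x σ * Φ σ = 0.
  eval-CoeffZero : ∀ {Φ} → Invariant Φ → ∀ x → CoeffZero x → eval Φ x ≈ 0#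
  eval-CoeffZero {Φ} invariant x = go (L.length x) x ≤-refl
    where
    go : ∀ n x → L.length x ≤ n → CoeffZero x → eval Φ x ≈ 0#
    go _       []                _               _    = 𝔽.refl
    go (suc n) x@((a , σ) ∷ x′) (s≤s |x′|≤n) vanish = begin
      eval Φ x
        ≈⟨ eval-select-split (inClass σ) Φ x ⟩
      eval Φ (class σ x) ⊕ eval Φ (rest σ x)
        ≈⟨ 𝔽.+-cong (eval-class invariant σ x) (go n (rest σ x) |rest|≤n (CoeffZero-rest σ x vanish)) ⟩
      coeff x σ * Φ σ ⊕ 0#
        ≈⟨ 𝔽.+-congʳ (𝔽.trans (𝔽.*-congʳ (vanish σ)) (𝔽.zeroˡ _)) ⟩
      0# ⊕ 0#
        ≈⟨ 𝔽.+-identityˡ 0# ⟩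
      0# ∎
      where
      |rest|≤n : L.length (rest σ x) ≤ n
      |rest|≤n rewrite sameB≡true (≈ᴰ-refl σ) = ≤-trans (length-select (not ∘ inClass σ) x′) |x′|≤n

  eval-resp-≈P : ∀ {Φ} → Invariant Φ → ∀ x y → x ≈P y → eval Φ x ≈ eval Φ y
  eval-resp-≈P {Φ} invariant x y x≈y = x∙y⁻¹≈ε⇒x≈y _ _ (begin
    eval Φ x ⊕ - eval Φ y   ≈⟨ 𝔽.sym (eval-difference Φ x y) ⟩
    eval Φ (x ++ negate y)  ≈⟨ eval-CoeffZero invariant (x ++ negate y) difference-vanishes ⟩
    0#                      ∎)
    where
    open import Algebra.Properties.Group 𝔽.+-group using (x∙y⁻¹≈ε⇒x≈y)
    difference-vanishes : CoeffZero (x ++ negate y)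
    difference-vanishes π = begin
      coeff (x ++ negate y) π
        ≈⟨ coeff≈eval (x ++ negate y) π ⟩
      eval (indicator π) (x ++ negate y)
        ≈⟨ eval-difference (indicator π) x y ⟩
      eval (indicator π) x ⊕ - eval (indicator π) y
        ≈⟨ 𝔽.sym (𝔽.+-cong (coeff≈eval x π) (𝔽.-‿cong (coeff≈eval y π))) ⟩
      coeff x π ⊕ - coeff y π
        ≈⟨ 𝔽.+-congʳ (x≈y π) ⟩
      coeff y π ⊕ - coeff y π
        ≈⟨ 𝔽.-‿inverseʳ _ ⟩
      0# ∎

-- Factorisations and the defining sums of Δ and S

filter-T-cong : ∀ {A : Set} {p q : A → Bool} → (∀ a → p a ≡ q a) →
                ∀ xs → L.filter (T? ∘ p) xs ≡ L.filter (T? ∘ q) xs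
filter-T-cong {p = p} {q} same =
  filter-≐ (T? ∘ p) (T? ∘ q) ((λ {a} → subst T (same a)) , (λ {a} → subst T (sym (same a))))

∈-filter-T⇒≡true : ∀ {A : Set} (p : A → Bool) xs {a} → a ∈ L.filter (T? ∘ p) xs → p a ≡ true
∈-filter-T⇒≡true p xs a∈ = Equivalence.to T-≡ (proj₂ (∈-filter⁻ (T? ∘ p) {xs = xs} a∈))

-- the list filtered by `decompositions`
nonemptyPairsOfOrder : ℕ → List (Basis × Basis)
nonemptyPairsOfOrder n =
  L.concatMap (λ jl → L.concatMap (λ ρ₁ → L.map (ρ₁ ,_) (allBasisOfOrder (proj₂ jl))) (allBasisOfOrder (proj₁ jl)))
              (L.map (λ j → suc j , n ∸ suc j) (L.upTo (n ∸ 1)))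

decompositions-≈ᴰ : ∀ {k} {d d′ : Diagram k} → (k , d) ≈ᴰ (k , d′) →
                    decompositions (k , d) ≡ decompositions (k , d′)
decompositions-≈ᴰ {k} same = filter-T-cong (λ ρs → sameB-respʳ (proj₁ ρs ⊗B proj₂ ρs) same) (nonemptyPairsOfOrder k)

∈-decompositions : ∀ {π ρ₁ ρ₂} → (ρ₁ , ρ₂) ∈ decompositions π → ρ₁ ⊗B ρ₂ ≈ᴰ π
∈-decompositions {π} =
  mk≈ᴰ ∘ ∈-filter-T⇒≡true (λ ρs → sameB (proj₁ ρs ⊗B proj₂ ρs) π) (nonemptyPairsOfOrder (order π))

irreducibleOrEmpty : Basis → Bool
irreducibleOrEmpty G = (order G ≡ᵇ 0) ∨ isIrreducible G

-- the list filtered by `Δirr`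
pairsOfOrder : ℕ → List (Basis × Basis)
pairsOfOrder n = L.concatMap (λ j → L.concatMap (λ G₁ → L.map (G₁ ,_) (allBasisOfOrder (n ∸ j))) (allBasisOfOrder j))
                             (L.upTo (suc n))

Δ-admissible : Basis → Basis × Basis → Bool
Δ-admissible π g = irreducibleOrEmpty (proj₁ g) ∧ irreducibleOrEmpty (proj₂ g) ∧ sameB (proj₁ g • proj₂ g) π

-- `irreducibleFactors π` is a private recursion `factorsWithFuel (order π) π`,
-- recovered from one unfolding step like the tests of `isPerfectMatching`.
private
  Unfolds₃ : (ℕ → Basis → List Basis) → Set
  Unfolds₃ factors = ∀ m d ρ₁ ρ₂ rest → decompositions (suc m , d) ≡ (ρ₁ , ρ₂) ∷ rest →
                     irreducibleFactors (suc m , d) ≡ ρ₁ ∷ factors m ρ₂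

  fuelled : Σ (ℕ → Basis → List Basis) Unfolds₃
  fuelled = _ , unfold
    where
    unfold : Unfolds₃ _
    unfold m d ρ₁ ρ₂ rest eq rewrite eq = refl

factorsWithFuel : ℕ → Basis → List Basis
factorsWithFuel = proj₁ fuelled

All-factorsWithFuel : ∀ {p} {P : Basis → Set p} → (∀ {σ τ} → σ ≈ᴰ τ → P σ → P τ) →
  (∀ σ τ → P (σ ⊗B τ) → P σ × P τ) → ∀ f σ → P σ → All P (factorsWithFuel f σ)
All-factorsWithFuel resp split f       (zero , d)  _  = []
All-factorsWithFuel resp split zero    (suc m , d) pσ = pσ ∷ []
All-factorsWithFuel resp split (suc f) (suc m , d) pσ with decompositions (suc m , d) in eq
... | []              = pσ ∷ []
... | (ρ₁ , ρ₂) ∷ _ =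
  let ρ₁⊗ρ₂≈σ  = ∈-decompositions (subst ((ρ₁ , ρ₂) ∈_) (sym eq) (here refl))
      pρ₁ , pρ₂ = split ρ₁ ρ₂ (resp (≈ᴰ-sym ρ₁⊗ρ₂≈σ) pσ)
  in pρ₁ ∷ All-factorsWithFuel resp split f ρ₂ pρ₂

map-factorsWithFuel-≈ᴰ : ∀ {y} {Y : Set y} (G : Basis → Y) → (∀ {σ τ} → σ ≈ᴰ τ → G σ ≡ G τ) →
  ∀ f k {d d′ : Diagram k} → (k , d) ≈ᴰ (k , d′) →
  L.map G (factorsWithFuel f (k , d)) ≡ L.map G (factorsWithFuel f (k , d′))
map-factorsWithFuel-≈ᴰ G resp f       zero    same = refl
map-factorsWithFuel-≈ᴰ G resp zero    (suc m) same = cong (_∷ []) (resp same)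
map-factorsWithFuel-≈ᴰ G resp (suc f) (suc m) {d} {d′} same
  rewrite decompositions-≈ᴰ same with decompositions (suc m , d′)
... | []            = cong (_∷ []) (resp same)
... | (ρ₁ , ρ₂) ∷ _ = refl

foldr-irreducibleFactors-≈ᴰ : ∀ {a y} {A : Set a} {Y : Set y} (G : Basis → Y) → (∀ {σ τ} → σ ≈ᴰ τ → G σ ≡ G τ) →
  (f : Y → A → A) (e : A) → ∀ {σ σ′} → σ ≈ᴰ σ′ →
  L.foldr (f ∘ G) e (irreducibleFactors σ) ≡ L.foldr (f ∘ G) e (irreducibleFactors σ′)
foldr-irreducibleFactors-≈ᴰ G resp f e {k , d} {k′ , d′} same with ≈ᴰ-order same
... | refl = begin
  L.foldr (f ∘ G) e (factorsWithFuel k (k , d))     ≡⟨ sym (foldr-map f G e (factorsWithFuel k (k , d))) ⟩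
  L.foldr f e (L.map G (factorsWithFuel k (k , d)))  ≡⟨ cong (L.foldr f e) (map-factorsWithFuel-≈ᴰ G resp k k same) ⟩
  L.foldr f e (L.map G (factorsWithFuel k (k , d′))) ≡⟨ foldr-map f G e (factorsWithFuel k (k , d′)) ⟩
  L.foldr (f ∘ G) e (factorsWithFuel k (k , d′))    ∎
  where open ≡-Reasoning

-- ParSym on the span of perfect matchings

module Support {c ℓ} (F : Field c ℓ) where
  open ParSym F
  open Coefficients F
  open Field F using (1#)

  PMSupported : ParSym → Set c
  PMSupported = All (PerfectMatching ∘ proj₂)

  PMSupported₂ : ParSym⊗ParSym → Set c
  PMSupported₂ = All (λ p → PerfectMatching (proj₁ (proj₂ p)) × PerfectMatching (proj₂ (proj₂ p)))

  PMSupported-· : ∀ {x y} → PMSupported x → PMSupported y → PMSupported (x · y)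
  PMSupported-· {y = y} px py = All-bind (λ _ → y) _⊗B_ (λ {σ} {τ} → PerfectMatching-⊗ σ τ) (λ _ → py) px

  PMSupported-product : ∀ {ρs} → All PerfectMatching ρs → PMSupported (L.foldr (λ ρ acc → H ρ · acc) (H ∅) ρs)
  PMSupported-product []           = tt ∷ []
  PMSupported-product (pmρ ∷ pmρs) = PMSupported-· (pmρ ∷ []) (PMSupported-product pmρs)

  PMSupported-Sirr : ∀ π → PerfectMatching π → PMSupported (Sirr π)
  PMSupported-Sirr π pm = All.concat⁺ (All.map⁺ (All.tabulate λ {ρs} ρs∈ →
    All.map⁺ (PMSupported-product (PerfectMatching-bulletAll⁻ ρs (PerfectMatching-≈ᴰ (≈ᴰ-sym (bullets≈π ρs ρs∈)) pm)))))
    where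
    bullets≈π : ∀ ρs → ρs ∈ L.filter (T? ∘ λ ρs → sameB (bulletAll ρs) π) (tuplesOfTotalOrder (order π)) →
                bulletAll ρs ≈ᴰ π
    bullets≈π ρs ρs∈ = mk≈ᴰ (∈-filter-T⇒≡true (λ ρs → sameB (bulletAll ρs) π) (tuplesOfTotalOrder (order π)) ρs∈)

  All-irreducibleFactors : ∀ σ → PerfectMatching σ → All PerfectMatching (irreducibleFactors σ)
  All-irreducibleFactors σ = All-factorsWithFuel PerfectMatching-≈ᴰ PerfectMatching-⊗⁻ (order σ) σ

  PMSupported-SH : ∀ σ → PerfectMatching σ → PMSupported (SH σ)
  PMSupported-SH σ pm = subst PMSupported (foldr-map (λ s acc → acc · s) Sirr (H ∅) (irreducibleFactors σ))
    (foldr-preservesᵇ {P = PMSupported} (λ ps pacc → PMSupported-· pacc ps) (tt ∷ [])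
      (All.map⁺ (All.map (λ {π} → PMSupported-Sirr π) (All-irreducibleFactors σ pm))))

  PMSupported-S : ∀ {x} → PMSupported x → PMSupported (S x)
  PMSupported-S = All-bind SH (λ _ τ → τ) (λ _ pm → pm) (λ {σ} → PMSupported-SH σ)

  PMSupported₂-·₂ : ∀ {z w} → PMSupported₂ z → PMSupported₂ w → PMSupported₂ (z ·₂ w)
  PMSupported₂-·₂ {w = w} pz pw =
    All-bind (λ _ → w) (λ g g′ → proj₁ g ⊗B proj₁ g′ , proj₂ g ⊗B proj₂ g′)
      (λ {g} {g′} (pm₁ , pm₂) (pm₁′ , pm₂′) →
        PerfectMatching-⊗ (proj₁ g) (proj₁ g′) pm₁ pm₁′ , PerfectMatching-⊗ (proj₂ g) (proj₂ g′) pm₂ pm₂′)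
      (λ _ → pw) pz

  PMSupported₂-Δirr : ∀ π → PerfectMatching π → PMSupported₂ (Δirr π)
  PMSupported₂-Δirr π pm = All.map⁺ (All.tabulate λ {g} g∈ →
    PerfectMatching-•⁻ (proj₁ g) (proj₂ g) (PerfectMatching-≈ᴰ (≈ᴰ-sym (bullet≈π g g∈)) pm))
    where
    bullet≈π : ∀ g → g ∈ L.filter (T? ∘ Δ-admissible π) (pairsOfOrder (order π)) → proj₁ g • proj₂ g ≈ᴰ π
    bullet≈π g g∈ = mk≈ᴰ (∧≡true⇒ʳ (irreducibleOrEmpty (proj₂ g)) (∧≡true⇒ʳ (irreducibleOrEmpty (proj₁ g))
      (∈-filter-T⇒≡true (Δ-admissible π) (pairsOfOrder (order π)) g∈)))

  PMSupported₂-ΔH : ∀ σ → PerfectMatching σ → PMSupported₂ (ΔH σ)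
  PMSupported₂-ΔH σ pm = subst PMSupported₂ (foldr-map _·₂_ Δirr ((1# , ∅ , ∅) ∷ []) (irreducibleFactors σ))
    (foldr-preservesᵇ {P = PMSupported₂} PMSupported₂-·₂ ((tt , tt) ∷ [])
      (All.map⁺ (All.map (λ {π} → PMSupported₂-Δirr π) (All-irreducibleFactors σ pm))))

  PMSupported₂-Δ : ∀ {x} → PMSupported x → PMSupported₂ (Δ x)
  PMSupported₂-Δ = All-bind ΔH (λ _ g → g) (λ _ pm → pm) (λ {σ} → PMSupported₂-ΔH σ)

module Invariance {c ℓ} (F : Field c ℓ) where
  open ParSym F
  open Coefficients F
  private module 𝔽 = Field F
  open 𝔽 using (Carrier; _≈_; 0#; 1#)
  open import Relation.Binary.Reasoning.Setoid 𝔽.setoid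

  Δirr-≈ᴰ : ∀ {σ σ′} → σ ≈ᴰ σ′ → Δirr σ ≡ Δirr σ′
  Δirr-≈ᴰ {k , d} {k′ , d′} same with ≈ᴰ-order same
  ... | refl = cong (L.map (1# ,_)) (filter-T-cong admissible-≈ᴰ (pairsOfOrder k))
    where
    admissible-≈ᴰ : ∀ g → Δ-admissible (k , d) g ≡ Δ-admissible (k , d′) g
    admissible-≈ᴰ g = cong (λ b → irreducibleOrEmpty (proj₁ g) ∧ irreducibleOrEmpty (proj₂ g) ∧ b)
                           (sameB-respʳ (proj₁ g • proj₂ g) same)

  Sirr-≈ᴰ : ∀ {σ σ′} → σ ≈ᴰ σ′ → Sirr σ ≡ Sirr σ′
  Sirr-≈ᴰ {k , d} {k′ , d′} same with ≈ᴰ-order same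
  ... | refl = cong (λ ρss → L.concatMap _ ρss)
                    (filter-T-cong (λ ρs → sameB-respʳ (bulletAll ρs) same) (tuplesOfTotalOrder k))

  SH-≈ᴰ : ∀ {σ σ′} → σ ≈ᴰ σ′ → SH σ ≡ SH σ′
  SH-≈ᴰ = foldr-irreducibleFactors-≈ᴰ Sirr Sirr-≈ᴰ (λ s acc → acc · s) (H ∅)

  ΔH-≈ᴰ : ∀ {σ σ′} → σ ≈ᴰ σ′ → ΔH σ ≡ ΔH σ′
  ΔH-≈ᴰ = foldr-irreducibleFactors-≈ᴰ Δirr Δirr-≈ᴰ _·₂_ ((1# , ∅ , ∅) ∷ [])

  indicator-≈ᴰ : ∀ π {σ σ′} → σ ≈ᴰ σ′ → indicator π σ ≡ indicator π σ′
  indicator-≈ᴰ π same = cong (if_then 1# else 0#) (sameB-respˡ π same)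

  eval-bind-resp-≈P : ∀ {Y Z : Set} (w : Y → Carrier) (G : Basis → List (Carrier × Z)) (h : Basis → Z → Y) →
    Invariant (λ σ → eval (w ∘ h σ) (G σ)) → ∀ x x′ → x ≈P x′ → eval w (bind G h x) ≈ eval w (bind G h x′)
  eval-bind-resp-≈P w G h invariant x x′ x≈x′ = 𝔽.trans (eval-bind w G h x)
    (𝔽.trans (eval-resp-≈P invariant x x′ x≈x′) (𝔽.sym (eval-bind w G h x′)))

  ·-resp-≈P : ∀ x x′ y y′ → x ≈P x′ → y ≈P y′ → (x · y) ≈P (x′ · y′)
  ·-resp-≈P x x′ y y′ x≈x′ y≈y′ π = begin
    coeff (x · y) π
      ≈⟨ coeff≈eval (x · y) π ⟩
    eval (indicator π) (x · y)
      ≈⟨ eval-bind-resp-≈P (indicator π) (λ _ → y) _⊗B_ left-invariant x x′ x≈x′ ⟩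
    eval (indicator π) (x′ · y)
      ≈⟨ eval-bind (indicator π) (λ _ → y) _⊗B_ x′ ⟩
    eval (λ σ → eval (indicator π ∘ (σ ⊗B_)) y) x′
      ≈⟨ eval-cong (λ σ → eval-resp-≈P (right-invariant σ) y y′ y≈y′) x′ ⟩
    eval (λ σ → eval (indicator π ∘ (σ ⊗B_)) y′) x′
      ≈⟨ 𝔽.sym (eval-bind (indicator π) (λ _ → y′) _⊗B_ x′) ⟩
    eval (indicator π) (x′ · y′)
      ≈⟨ 𝔽.sym (coeff≈eval (x′ · y′) π) ⟩
    coeff (x′ · y′) π ∎
    where
    left-invariant : Invariant (λ σ → eval (indicator π ∘ (σ ⊗B_)) y)
    left-invariant same = eval-cong (λ τ → 𝔽.reflexive (indicator-≈ᴰ π (⊗-resp-≈ᴰ same (≈ᴰ-refl τ)))) y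
    right-invariant : ∀ σ → Invariant (indicator π ∘ (σ ⊗B_))
    right-invariant σ same = 𝔽.reflexive (indicator-≈ᴰ π (⊗-resp-≈ᴰ (≈ᴰ-refl σ) same))

  Δ-resp-≈P : ∀ x x′ → x ≈P x′ → Δ x ≈P₂ Δ x′
  Δ-resp-≈P x x′ x≈x′ π ρ = begin
    coeff₂ (Δ x) π ρ             ≈⟨ coeff₂≈eval (Δ x) π ρ ⟩
    eval (indicator₂ π ρ) (Δ x)  ≈⟨ eval-bind-resp-≈P (indicator₂ π ρ) ΔH (λ _ g → g) invariant x x′ x≈x′ ⟩
    eval (indicator₂ π ρ) (Δ x′) ≈⟨ 𝔽.sym (coeff₂≈eval (Δ x′) π ρ) ⟩
    coeff₂ (Δ x′) π ρ            ∎
    where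
    invariant : Invariant (eval (indicator₂ π ρ) ∘ ΔH)
    invariant same = 𝔽.reflexive (cong (eval (indicator₂ π ρ)) (ΔH-≈ᴰ same))

  S-resp-≈P : ∀ x x′ → x ≈P x′ → S x ≈P S x′
  S-resp-≈P x x′ x≈x′ π = begin
    coeff (S x) π            ≈⟨ coeff≈eval (S x) π ⟩
    eval (indicator π) (S x)  ≈⟨ eval-bind-resp-≈P (indicator π) SH (λ _ τ → τ) invariant x x′ x≈x′ ⟩
    eval (indicator π) (S x′) ≈⟨ 𝔽.sym (coeff≈eval (S x′) π) ⟩
    coeff (S x′) π            ∎
    where
    invariant : Invariant (eval (indicator π) ∘ SH)
    invariant same = 𝔽.reflexive (cong (eval (indicator π)) (SH-≈ᴰ same))

theorem4p3 : ∀ {c ℓ : Level} (F : Field c ℓ) → let open ParSym F in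
    InPMSpan (H ∅)
    × (∀ x y → InPMSpan x → InPMSpan y → InPMSpan (x · y))
    × (∀ x → InPMSpan x → InPMSpan⊗PMSpan (Δ x))
    × (∀ x → InPMSpan x → InPMSpan (S x))
theorem4p3 F =
    (H ∅ , tt ∷ [] , λ π → 𝔽.refl)
  , (λ x y (ys , pys , x≈ys) (zs , pzs , y≈zs) →
       ys · zs , PMSupported-· pys pzs , ·-resp-≈P x ys y zs x≈ys y≈zs)
  , (λ x (ys , pys , x≈ys) → Δ ys , PMSupported₂-Δ pys , Δ-resp-≈P x ys x≈ys)
  , (λ x (ys , pys , x≈ys) → S ys , PMSupported-S pys , S-resp-≈P x ys x≈ys)
  where
  open ParSym F
  open Invariance F
  open Support F
  module 𝔽 = Field F
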